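{- Let $h\geq 2$ be an integer and let $A$ be a finite set of $k$ nonnegative integers with $0\in A$. Then $|h_{\pm}A|=2hk-2h+1$ if and only if $A=d*[0,k-1]$ for some positive integer $d$.
   Context: For a finite set $A=\{a_0,a_1,\ldots,a_{k-1}\}$ of integers and a positive integer $h$, the $h$-fold signed sumset of $A$ is \[h_{\pm}A=\Big\{\sum_{i=0}^{k-1}\lambda_i a_i : (\lambda_0,\ldots,\lambda_{k-1})\in\mathbb{Z}^k,\ \sum_{i=0}^{k-1}|\lambda_i|=h\Big\}.\] $[0,k-1]$ denotes the set of integers $\{0,1,\ldots,k-1\}$, and for an integer $d$ and a set $B$ of integers, $d*B=\{db : b\in B\}$. -}

module Defs where

open import Data.Nat using (ℕ; zero; suc; _<_)
open import Data.Integer using (ℤ; +_; _+_; _*_; ∣_∣)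
open import Data.Fin using (Fin; zero; suc)
open import Data.List using (List; length; lookup)
open import Data.List.Membership.Propositional using (_∈_)
open import Data.List.Relation.Unary.Unique.Propositional using (Unique)
open import Data.Product using (Σ; ∃; _×_)
open import Function.Bundles using (_⇔_)
open import Relation.Binary.PropositionalEquality using (_≡_)

sumℤ : ∀ {k} → (Fin k → ℤ) → ℤ
sumℤ {zero} f = + 0
sumℤ {suc k} f = f zero + sumℤ (λ i → f (suc i))

sumℕ : ∀ {k} → (Fin k → ℕ) → ℕ
sumℕ {zero} f = 0
sumℕ {suc k} f = f zero Data.Nat.+ sumℕ (λ i → f (suc i))

-- x ∈ h_± A, where A = {a_0,...,a_{k-1}} is given by a duplicate-free list
InSignedSumset : ℕ → List ℕ → ℤ → Set
InSignedSumset h A x =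
  Σ (Fin (length A) → ℤ) λ c →
    (sumℕ (λ i → ∣ c i ∣) ≡ h) × (sumℤ (λ i → c i * + (lookup A i)) ≡ x)

HasCard : (ℤ → Set) → ℕ → Set
HasCard S n = Σ (List ℤ) λ L → Unique L × (length L ≡ n) × (∀ x → (x ∈ L) ⇔ S x)

IsDilatedInterval : List ℕ → ℕ → ℕ → Set
IsDilatedInterval A d k = ∀ x → (x ∈ A) ⇔ (∃ λ i → (i < k) × (x ≡ d Data.Nat.* i))

-- Let 0 = s 0 < s 1 < … < s k enumerate A. Replacing the h copies of s j by copies of s (j + 1) one
-- at a time walks from h · s 0 to h · s k through the hk + 1 strictly increasing h-fold sums
-- (h − r) · s j + r · s (j + 1), the staircase; with their negatives these are 2hk + 1 distinct
-- elements of h±A. If |h±A| = 2hk + 1 they exhaust h±A, so the h-fold sum s i + (h − 2) · s (i + 1) +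
-- s (i + 2), which lies strictly between the staircase points s i + (h − 1) · s (i + 1) and
-- (h − 1) · s (i + 1) + s (i + 2), must be the point h · s (i + 1) between them; hence A is an
-- arithmetic progression. Conversely, if A = d · [0, k] every signed sum is d · y with |y| ≤ hk,
-- and the staircase is exactly d · [0, hk].
module Submission where

open import Defs
open import Relation.Binary.PropositionalEquality
open import Data.Nat using (ℕ; zero; suc; _+_; _*_; _∸_; _≤_; _<_; z≤n; s≤s; NonZero; >-nonZero)
import Data.Nat.Properties as ℕ
open import Data.Nat.DivMod
  using (_/_; _%_; m≡m%n+[m/n]*n; m%n<n; [m+kn]%n≡m%n; m<n⇒m%n≡m; m*n%n≡0; +-distrib-/; m<n⇒m/n≡0; m*n/n≡m)
open import Data.Nat.Tactic.RingSolver using (solve-∀)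
open import Data.Integer as ℤ using (ℤ; +_; -[1+_]; ∣_∣)
import Data.Integer.Properties as ℤ
import Data.Integer.Tactic.RingSolver as ℤ
open import Data.Fin using (Fin; zero; suc)
open import Data.List using (List; []; _∷_; _++_; length; lookup; map; upTo; removeAt)
open import Data.List.Properties using (length-++; length-map; length-upTo; length-removeAt′)
open import Data.List.Membership.Propositional using (_∈_)
open import Data.List.Membership.Propositional.Properties
  using (∈-lookup; ∈-map⁺; ∈-map⁻; ∈-++⁺ˡ; ∈-++⁺ʳ; ∈-++⁻; ∈-upTo⁺; ∈-upTo⁻)
open import Data.List.Membership.DecPropositional ℤ._≟_ using (_∈?_)
open import Data.List.Relation.Binary.Subset.Propositional using (_⊆_)
open import Data.List.Relation.Binary.Permutation.Propositional using (_↭_; ↭-sym; ↭⇒↭ₛ)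
open import Data.List.Relation.Binary.Permutation.Propositional.Properties using (∈-resp-↭; ↭-length)
open import Data.List.Relation.Binary.Permutation.Setoid.Properties (setoid ℕ) using (Unique-resp-↭)
open import Data.List.Relation.Unary.Any using (here; there; index)
open import Data.List.Relation.Unary.Any.Properties using (lookup-index)
import Data.List.Relation.Unary.All as All
open import Data.List.Relation.Unary.AllPairs using (_∷_)
open import Data.List.Relation.Unary.Linked using (Linked; []; [-]; _∷_)
open import Data.List.Relation.Unary.Unique.Propositional using (Unique)
import Data.List.Relation.Unary.Unique.Propositional.Properties as Unique
open import Data.List.Sort ℕ.≤-decTotalOrder using (sort; sort-↭; sort-↗)
open import Data.Product using (Σ; ∃; _×_; _,_; proj₁; proj₂)
open import Data.Sum using (inj₁; inj₂)
open import Data.Empty using (⊥-elim)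
open import Function.Bundles using (_⇔_; mk⇔; Equivalence)
open import Relation.Nullary using (¬_; yes; no)
open import Relation.Binary.Definitions using (tri<; tri≈; tri>)

sumℕ-cong : ∀ {n} {f g : Fin n → ℕ} → (∀ i → f i ≡ g i) → sumℕ f ≡ sumℕ g
sumℕ-cong {zero}  f≗g = refl
sumℕ-cong {suc n} f≗g = cong₂ _+_ (f≗g zero) (sumℕ-cong (λ i → f≗g (suc i)))

sumℕ-zero : ∀ n → sumℕ {n} (λ _ → 0) ≡ 0
sumℕ-zero zero    = refl
sumℕ-zero (suc n) = sumℕ-zero n

sumℕ-distrib-+ : ∀ {n} (f g : Fin n → ℕ) → sumℕ (λ i → f i + g i) ≡ sumℕ f + sumℕ g
sumℕ-distrib-+ {zero}  f g = refl
sumℕ-distrib-+ {suc n} f g =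
  trans (cong (_+_ (f zero + g zero)) (sumℕ-distrib-+ (λ i → f (suc i)) (λ i → g (suc i))))
        (interchange (f zero) (g zero) _ _)
  where
  interchange : ∀ a b c d → a + b + (c + d) ≡ a + c + (b + d)
  interchange = solve-∀

indicator : ∀ {n} → Fin n → Fin n → ℕ
indicator zero    zero    = 1
indicator zero    (suc j) = 0
indicator (suc i) zero    = 0
indicator (suc i) (suc j) = indicator i j

sumℕ-indicator-* : ∀ {n} (i : Fin n) (f : Fin n → ℕ) → sumℕ (λ j → indicator i j * f j) ≡ f i
sumℕ-indicator-* {suc n} zero    f =
  trans (cong₂ _+_ (ℕ.+-identityʳ (f zero)) (sumℕ-zero n)) (ℕ.+-identityʳ (f zero))
sumℕ-indicator-* (suc i) f = sumℕ-indicator-* i (λ j → f (suc j))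

sumℤ-cong : ∀ {n} {f g : Fin n → ℤ} → (∀ i → f i ≡ g i) → sumℤ f ≡ sumℤ g
sumℤ-cong {zero}  f≗g = refl
sumℤ-cong {suc n} f≗g = cong₂ ℤ._+_ (f≗g zero) (sumℤ-cong (λ i → f≗g (suc i)))

sumℤ-neg : ∀ {n} (f : Fin n → ℤ) → sumℤ (λ i → ℤ.- f i) ≡ ℤ.- sumℤ f
sumℤ-neg {zero}  f = refl
sumℤ-neg {suc n} f =
  trans (cong (ℤ._+_ (ℤ.- f zero)) (sumℤ-neg (λ i → f (suc i))))
        (sym (ℤ.neg-distrib-+ (f zero) _))

pos-sumℕ : ∀ {n} (f : Fin n → ℕ) → + sumℕ f ≡ sumℤ (λ i → + f i)
pos-sumℕ {zero}  f = refl
pos-sumℕ {suc n} f =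
  trans (ℤ.pos-+ (f zero) _) (cong (ℤ._+_ (+ f zero)) (pos-sumℕ (λ i → f (suc i))))

*-distribˡ-sumℤ : ∀ {n} a (f : Fin n → ℤ) → a ℤ.* sumℤ f ≡ sumℤ (λ i → a ℤ.* f i)
*-distribˡ-sumℤ {zero}  a f = ℤ.*-zeroʳ a
*-distribˡ-sumℤ {suc n} a f =
  trans (ℤ.*-distribˡ-+ a (f zero) _)
        (cong (ℤ._+_ (a ℤ.* f zero)) (*-distribˡ-sumℤ a (λ i → f (suc i))))

∣sumℤ-*∣≤ : ∀ {n} K (c : Fin n → ℤ) (m : Fin n → ℕ) → (∀ i → m i ≤ K) →
            ∣ sumℤ (λ i → c i ℤ.* + m i) ∣ ≤ sumℕ (λ i → ∣ c i ∣) * K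
∣sumℤ-*∣≤ {zero}  K c m m≤K = z≤n
∣sumℤ-*∣≤ {suc n} K c m m≤K = begin
  ∣ c zero ℤ.* + m zero ℤ.+ rest ∣      ≤⟨ ℤ.∣i+j∣≤∣i∣+∣j∣ (c zero ℤ.* + m zero) rest ⟩
  ∣ c zero ℤ.* + m zero ∣ + ∣ rest ∣    ≡⟨ cong (_+ ∣ rest ∣) (ℤ.∣i*j∣≡∣i∣*∣j∣ (c zero) (+ m zero)) ⟩
  ∣ c zero ∣ * m zero + ∣ rest ∣        ≤⟨ ℕ.+-mono-≤ (ℕ.*-monoʳ-≤ ∣ c zero ∣ (m≤K zero)) rest-bound ⟩
  ∣ c zero ∣ * K + ∑∣c′∣ * K           ≡⟨ ℕ.*-distribʳ-+ K ∣ c zero ∣ ∑∣c′∣ ⟨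
  sumℕ (λ i → ∣ c i ∣) * K              ∎
  where
  open ℕ.≤-Reasoning
  rest = sumℤ (λ i → c (suc i) ℤ.* + m (suc i))
  ∑∣c′∣ = sumℕ (λ i → ∣ c (suc i) ∣)
  rest-bound : ∣ rest ∣ ≤ ∑∣c′∣ * K
  rest-bound = ∣sumℤ-*∣≤ K (λ i → c (suc i)) (λ i → m (suc i)) (λ i → m≤K (suc i))

sumℤ-dilated : ∀ {n} d (c : Fin n → ℤ) (m : Fin n → ℕ) →
               sumℤ (λ i → c i ℤ.* + (d * m i)) ≡ + d ℤ.* sumℤ (λ i → c i ℤ.* + m i)
sumℤ-dilated d c m = trans (sumℤ-cong factor) (sym (*-distribˡ-sumℤ (+ d) (λ i → c i ℤ.* + m i)))
  where
  swap : ∀ x y z → x ℤ.* (y ℤ.* z) ≡ y ℤ.* (x ℤ.* z)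
  swap = ℤ.solve-∀
  factor : ∀ i → c i ℤ.* + (d * m i) ≡ + d ℤ.* (c i ℤ.* + m i)
  factor i = trans (cong (ℤ._*_ (c i)) (ℤ.pos-* d (m i))) (swap (c i) (+ d) (+ m i))

InSumset : ℕ → List ℕ → ℕ → Set
InSumset n A x = Σ (Fin (length A) → ℕ) λ c → (sumℕ c ≡ n) × (sumℕ (λ i → c i * lookup A i) ≡ x)

module _ {A : List ℕ} where

  InSumset-zero : InSumset 0 A 0
  InSumset-zero = (λ _ → 0) , sumℕ-zero (length A) , sumℕ-zero (length A)

  InSumset-single : ∀ {a} → a ∈ A → InSumset 1 A a
  InSumset-single a∈A = indicator i ,
    trans (sumℕ-cong (λ j → sym (ℕ.*-identityʳ (indicator i j)))) (sumℕ-indicator-* i (λ _ → 1)) ,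
    trans (sumℕ-indicator-* i (lookup A)) (sym (lookup-index a∈A))
    where i = index a∈A

  InSumset-+ : ∀ {m n x y} → InSumset m A x → InSumset n A y → InSumset (m + n) A (x + y)
  InSumset-+ (c , ∑c , ∑ca) (c′ , ∑c′ , ∑c′a) = (λ i → c i + c′ i) ,
    trans (sumℕ-distrib-+ c c′) (cong₂ _+_ ∑c ∑c′) ,
    trans (sumℕ-cong (λ i → ℕ.*-distribʳ-+ (lookup A i) (c i) (c′ i)))
          (trans (sumℕ-distrib-+ (λ i → c i * lookup A i) (λ i → c′ i * lookup A i))
                 (cong₂ _+_ ∑ca ∑c′a))

  InSumset-replicate : ∀ {a} → a ∈ A → ∀ m → InSumset m A (m * a)
  InSumset-replicate a∈A zero    = InSumset-zero
  InSumset-replicate a∈A (suc m) = InSumset-+ (InSumset-single a∈A) (InSumset-replicate a∈A m)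

  InSumset⇒InSignedSumset : ∀ {n x} → InSumset n A x → InSignedSumset n A (+ x)
  InSumset⇒InSignedSumset (c , ∑c , ∑ca) = (λ i → + c i) , ∑c ,
    trans (sumℤ-cong (λ i → sym (ℤ.pos-* (c i) (lookup A i))))
          (trans (sym (pos-sumℕ (λ i → c i * lookup A i))) (cong +_ ∑ca))

  InSignedSumset-neg : ∀ {n x} → InSignedSumset n A x → InSignedSumset n A (ℤ.- x)
  InSignedSumset-neg (c , ∑∣c∣ , ∑ca) = (λ i → ℤ.- c i) ,
    trans (sumℕ-cong (λ i → ℤ.∣-i∣≡∣i∣ (c i))) ∑∣c∣ ,
    trans (sumℤ-cong (λ i → sym (ℤ.neg-distribˡ-* (c i) _)))
          (trans (sumℤ-neg (λ i → c i ℤ.* + lookup A i)) (cong ℤ.-_ ∑ca))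

StrictlyIncreasing : (ℕ → ℕ) → Set
StrictlyIncreasing f = ∀ t → f t < f (suc t)

module _ {f : ℕ → ℕ} (f↑ : StrictlyIncreasing f) where

  strictlyIncreasing-mono-< : ∀ {t u} → t < u → f t < f u
  strictlyIncreasing-mono-< {t} {suc u} t<1+u with ℕ.m<1+n⇒m<n∨m≡n t<1+u
  ... | inj₁ t<u  = ℕ.<-trans (strictlyIncreasing-mono-< t<u) (f↑ u)
  ... | inj₂ refl = f↑ t

  strictlyIncreasing-mono-≤ : ∀ {t u} → t ≤ u → f t ≤ f u
  strictlyIncreasing-mono-≤ t≤u with ℕ.m≤n⇒m<n∨m≡n t≤u
  ... | inj₁ t<u  = ℕ.<⇒≤ (strictlyIncreasing-mono-< t<u)
  ... | inj₂ refl = ℕ.≤-refl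

  strictlyIncreasing-cancel-< : ∀ {t u} → f t < f u → t < u
  strictlyIncreasing-cancel-< {t} {u} ft<fu with ℕ.<-cmp t u
  ... | tri< t<u _ _  = t<u
  ... | tri≈ _ refl _ = ⊥-elim (ℕ.<-irrefl refl ft<fu)
  ... | tri> _ _ u<t  = ⊥-elim (ℕ.<-asym ft<fu (strictlyIncreasing-mono-< u<t))

  strictlyIncreasing-injective : ∀ {t u} → f t ≡ f u → t ≡ u
  strictlyIncreasing-injective {t} {u} ft≡fu with ℕ.<-cmp t u
  ... | tri< t<u _ _ = ⊥-elim (ℕ.<-irrefl ft≡fu (strictlyIncreasing-mono-< t<u))
  ... | tri≈ _ t≡u _ = t≡u
  ... | tri> _ _ u<t = ⊥-elim (ℕ.<-irrefl (sym ft≡fu) (strictlyIncreasing-mono-< u<t))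

  strictlyIncreasing-between : ∀ {t u} → f t < f u → f u < f (suc (suc t)) → u ≡ suc t
  strictlyIncreasing-between ft<fu fu<f[2+t] =
    ℕ.≤-antisym (ℕ.≤-pred (strictlyIncreasing-cancel-< fu<f[2+t])) (strictlyIncreasing-cancel-< ft<fu)

-- IsDilatedInterval A d n is, by definition, Enumerates (d *_) n A.
Enumerates : (ℕ → ℕ) → ℕ → List ℕ → Set
Enumerates s n A = ∀ x → x ∈ A ⇔ ∃ λ j → j < n × x ≡ s j

module _ {s : ℕ → ℕ} {n : ℕ} {A : List ℕ} (s-enum : Enumerates s n A) where

  enumerates-∈ : ∀ {j} → j < n → s j ∈ A
  enumerates-∈ {j} j<n = Equivalence.from (s-enum (s j)) (j , j<n , refl)

  enumerates-cong : ∀ {s′} → (∀ j → j < n → s j ≡ s′ j) → Enumerates s′ n A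
  enumerates-cong s≡s′ x = mk⇔
    (λ x∈A → let (j , j<n , x≡sj) = Equivalence.to (s-enum x) x∈A in j , j<n , trans x≡sj (s≡s′ j j<n))
    (λ (j , j<n , x≡s′j) → Equivalence.from (s-enum x) (j , j<n , trans x≡s′j (sym (s≡s′ j j<n))))

  enumerates-resp-↭ : ∀ {B} → A ↭ B → Enumerates s n B
  enumerates-resp-↭ A↭B x = mk⇔
    (λ x∈B → Equivalence.to (s-enum x) (∈-resp-↭ (↭-sym A↭B) x∈B))
    (λ j → ∈-resp-↭ A↭B (Equivalence.from (s-enum x) j))

-- The list read as a sequence, continued past its last element (or past b, if it is empty)
-- by steps of 1.
ascending : ℕ → List ℕ → ℕ → ℕ
ascending b []       j       = suc (j + b)
ascending b (x ∷ xs) zero    = x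
ascending b (x ∷ xs) (suc j) = ascending x xs j

ascending-increasing : ∀ b {xs} → Linked _<_ xs → StrictlyIncreasing (ascending b xs)
ascending-increasing b []        j       = ℕ.n<1+n _
ascending-increasing b [-]       zero    = ℕ.n<1+n _
ascending-increasing b [-]       (suc j) = ascending-increasing _ [] j
ascending-increasing b (x<y ∷ _) zero    = x<y
ascending-increasing b (_ ∷ xs↑) (suc j) = ascending-increasing _ xs↑ j

ascending-enumerates : ∀ b xs → Enumerates (ascending b xs) (length xs) xs
ascending-enumerates b xs x = mk⇔ (position b xs) (member b xs)
  where
  position : ∀ b xs → x ∈ xs → ∃ λ j → j < length xs × x ≡ ascending b xs j
  position b (y ∷ ys) (here x≡y)   = zero , s≤s z≤n , x≡y
  position b (y ∷ ys) (there x∈ys) =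
    let (j , j<n , x≡ys[j]) = position y ys x∈ys in suc j , s≤s j<n , x≡ys[j]
  member : ∀ b xs → (∃ λ j → j < length xs × x ≡ ascending b xs j) → x ∈ xs
  member b (y ∷ ys) (zero  , _ , x≡y)             = here x≡y
  member b (y ∷ ys) (suc j , s≤s j<n , x≡ys[j]) = there (member y ys (j , j<n , x≡ys[j]))

sorted∧unique⇒strictlySorted : ∀ {xs} → Linked _≤_ xs → Unique xs → Linked _<_ xs
sorted∧unique⇒strictlySorted []          _                      = []
sorted∧unique⇒strictlySorted [-]         _                      = [-]
sorted∧unique⇒strictlySorted (x≤y ∷ xs↗) ((x≢y All.∷ _) ∷ xs!) =
  ℕ.≤∧≢⇒< x≤y x≢y ∷ sorted∧unique⇒strictlySorted xs↗ xs!

increasingEnumeration : ∀ A → Unique A → Σ (ℕ → ℕ) λ s → StrictlyIncreasing s × Enumerates s (length A) A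
increasingEnumeration A A! = s , ascending-increasing 0 sortA↑ ,
  subst (λ n → Enumerates s n A) (↭-length (sort-↭ A))
        (enumerates-resp-↭ (ascending-enumerates 0 (sort A)) (sort-↭ A))
  where
  s = ascending 0 (sort A)
  sortA↑ : Linked _<_ (sort A)
  sortA↑ = sorted∧unique⇒strictlySorted (sort-↗ A) (Unique-resp-↭ (↭⇒↭ₛ (↭-sym (sort-↭ A))) A!)

∈-removeAt : ∀ {A : Set} {x y : A} {xs} (x∈xs : x ∈ xs) → y ∈ xs → y ≢ x → y ∈ removeAt xs (index x∈xs)
∈-removeAt (here refl)  (here refl)  y≢x = ⊥-elim (y≢x refl)
∈-removeAt (here _)     (there y∈xs) _   = y∈xs
∈-removeAt (there _)    (here y≡z)   _   = here y≡z
∈-removeAt (there x∈xs) (there y∈xs) y≢x = there (∈-removeAt x∈xs y∈xs y≢x)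

unique∧⊆⇒length-≤ : ∀ {A : Set} {xs ys : List A} → Unique xs → xs ⊆ ys → length xs ≤ length ys
unique∧⊆⇒length-≤ {xs = []}          _            _     = z≤n
unique∧⊆⇒length-≤ {xs = x ∷ xs} {ys} (x∉xs ∷ xs!) xs⊆ys = begin
  suc (length xs)                            ≤⟨ s≤s (unique∧⊆⇒length-≤ xs! xs⊆ys−x) ⟩
  suc (length (removeAt ys (index x∈ys)))    ≡⟨ length-removeAt′ ys (index x∈ys) ⟨
  length ys                                  ∎
  where
  open ℕ.≤-Reasoning
  x∈ys = xs⊆ys (here refl)
  xs⊆ys−x : xs ⊆ removeAt ys (index x∈ys)
  xs⊆ys−x y∈xs = ∈-removeAt x∈ys (xs⊆ys (there y∈xs)) (λ y≡x → All.lookup x∉xs y∈xs (sym y≡x))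

HasCard-saturated : ∀ {S n L} → HasCard S n → Unique L → length L ≡ n → (∀ {x} → x ∈ L → S x) →
                    ∀ {x} → S x → x ∈ L
HasCard-saturated {S} {n} {L} (E , E! , |E|≡n , E≡S) L! |L|≡n L⊆S {x} Sx with x ∈? L
... | yes x∈L = x∈L
... | no  x∉L = ⊥-elim (ℕ.n≮n n (subst₂ _<_ |L|≡n |E|≡n (unique∧⊆⇒length-≤ x∷L! x∷L⊆E)))
  where
  x∷L! : Unique (x ∷ L)
  x∷L! = All.tabulate (λ y∈L x≡y → x∉L (subst (_∈ L) (sym x≡y) y∈L)) ∷ L!
  x∷L⊆E : x ∷ L ⊆ E
  x∷L⊆E (here refl) = Equivalence.from (E≡S x) Sx
  x∷L⊆E (there y∈L) = Equivalence.from (E≡S _) (L⊆S y∈L)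

symmetricRange : ℕ → List ℤ
symmetricRange n = map +_ (upTo (suc n)) ++ map -[1+_] (upTo n)

length-symmetricRange : ∀ n → length (symmetricRange n) ≡ suc (n + n)
length-symmetricRange n = begin
  length (map +_ (upTo (suc n)) ++ map -[1+_] (upTo n))          ≡⟨ length-++ (map +_ (upTo (suc n))) ⟩
  length (map +_ (upTo (suc n))) + length (map -[1+_] (upTo n))  ≡⟨ cong₂ _+_ (length-map +_ (upTo (suc n)))
                                                                               (length-map -[1+_] (upTo n)) ⟩
  length (upTo (suc n)) + length (upTo n)                        ≡⟨ cong₂ _+_ (length-upTo (suc n)) (length-upTo n) ⟩
  suc (n + n)                                                    ∎
  where open ≡-Reasoning

symmetricRange-unique : ∀ n → Unique (symmetricRange n)
symmetricRange-unique n =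
  Unique.++⁺ (Unique.map⁺ ℤ.+-injective (Unique.upTo⁺ (suc n)))
             (Unique.map⁺ ℤ.-[1+-injective (Unique.upTo⁺ n))
             disjoint
  where
  disjoint : ∀ {y} → ¬ (y ∈ map +_ (upTo (suc n)) × y ∈ map -[1+_] (upTo n))
  disjoint (y∈⁺ , y∈⁻) with ∈-map⁻ +_ y∈⁺ | ∈-map⁻ -[1+_] y∈⁻
  ... | _ , _ , refl | _ , _ , ()

∈-symmetricRange⁺ : ∀ {n y} → ∣ y ∣ ≤ n → y ∈ symmetricRange n
∈-symmetricRange⁺ {n} {+ t}       t≤n   = ∈-++⁺ˡ (∈-map⁺ +_ (∈-upTo⁺ (s≤s t≤n)))
∈-symmetricRange⁺ {n} { -[1+ t ]} 1+t≤n = ∈-++⁺ʳ (map +_ (upTo (suc n))) (∈-map⁺ -[1+_] (∈-upTo⁺ 1+t≤n))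

∈-symmetricRange⁻ : ∀ {n y} → y ∈ symmetricRange n → ∣ y ∣ ≤ n
∈-symmetricRange⁻ {n} y∈ with ∈-++⁻ (map +_ (upTo (suc n))) y∈
... | inj₁ y∈⁺ with ∈-map⁻ +_ y∈⁺
...   | t , t∈ , refl = ℕ.≤-pred (∈-upTo⁻ t∈)
∈-symmetricRange⁻ {n} y∈ | inj₂ y∈⁻ with ∈-map⁻ -[1+_] y∈⁻
...   | t , t∈ , refl = ∈-upTo⁻ t∈

oddExtension : (ℕ → ℕ) → ℤ → ℤ
oddExtension f (+ t)    = + f t
oddExtension f -[1+ t ] = ℤ.- (+ f (suc t))

module _ {f : ℕ → ℕ} (f↑ : StrictlyIncreasing f) where

  oddExtension-nonneg : ∀ {y n} → oddExtension f y ≡ + n → ∃ λ t → y ≡ + t × n ≡ f t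
  oddExtension-nonneg {+ t}       refl = t , refl , refl
  oddExtension-nonneg { -[1+ t ]} fy≡n =
    ⊥-elim (neg≢pos (ℕ.≤-<-trans z≤n (strictlyIncreasing-mono-< f↑ (s≤s (z≤n {t})))) fy≡n)
    where
    neg≢pos : ∀ {m n} → 0 < m → ℤ.- (+ m) ≢ + n
    neg≢pos {suc m} _ ()

  oddExtension-injective : ∀ {y z} → oddExtension f y ≡ oddExtension f z → y ≡ z
  oddExtension-injective {y} {+ u} fy≡fz with oddExtension-nonneg {y} fy≡fz
  ... | t , refl , fu≡ft = cong +_ (strictlyIncreasing-injective f↑ (sym fu≡ft))
  oddExtension-injective {+ t} { -[1+ u ]} fy≡fz with oddExtension-nonneg { -[1+ u ]} (sym fy≡fz)
  ... | _ , () , _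
  oddExtension-injective { -[1+ t ]} { -[1+ u ]} fy≡fz =
    cong -[1+_] (ℕ.suc-injective (strictlyIncreasing-injective f↑ (ℤ.+-injective (ℤ.neg-injective fy≡fz))))

module Staircase (h : ℕ) .{{_ : NonZero h}} (s : ℕ → ℕ) where

  stair : ℕ → ℕ → ℕ
  stair j r = (h ∸ r) * s j + r * s (suc j)

  staircase : ℕ → ℕ
  staircase t = stair (t / h) (t % h)

  staircase-+* : ∀ {r} j → r < h → staircase (r + j * h) ≡ stair j r
  staircase-+* {r} j r<h = cong₂ stair quotient remainder
    where
    remainder : (r + j * h) % h ≡ r
    remainder = trans ([m+kn]%n≡m%n r j h) (m<n⇒m%n≡m r<h)
    quotient : (r + j * h) / h ≡ j
    quotient = trans (+-distrib-/ r (j * h) no-carry) (cong₂ _+_ (m<n⇒m/n≡0 r<h) (m*n/n≡m j h))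
      where
      open ℕ.≤-Reasoning
      no-carry : r % h + j * h % h < h
      no-carry = begin-strict
        r % h + j * h % h   ≡⟨ cong₂ _+_ (m<n⇒m%n≡m r<h) (m*n%n≡0 j h) ⟩
        r + 0               ≡⟨ ℕ.+-identityʳ r ⟩
        r                   <⟨ r<h ⟩
        h                   ∎

  -- stair j h and stair (suc j) 0 are the same point h · s (suc j).
  staircase-suc : ∀ {r} j → r < h → staircase (suc r + j * h) ≡ stair j (suc r)
  staircase-suc {r} j r<h with ℕ.m≤n⇒m<n∨m≡n r<h
  ... | inj₁ 1+r<h = staircase-+* j 1+r<h
  ... | inj₂ refl  = begin
    staircase (suc r + j * suc r)   ≡⟨ staircase-+* (suc j) (s≤s z≤n) ⟩
    suc r * s (suc j) + 0           ≡⟨ ℕ.+-identityʳ _ ⟩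
    suc r * s (suc j)               ≡⟨ cong (λ m → m * s j + suc r * s (suc j)) (ℕ.n∸n≡0 r) ⟨
    stair j (suc r)                 ∎
    where open ≡-Reasoning

  stair-suc : ∀ {r} j → r < h → stair j r + s (suc j) ≡ stair j (suc r) + s j
  stair-suc {r} j r<h = begin
    (h ∸ r) * s j + r * s (suc j) + s (suc j)
      ≡⟨ cong (λ m → m * s j + r * s (suc j) + s (suc j)) (ℕ.+-∸-assoc 1 r<h) ⟩
    suc (h ∸ suc r) * s j + r * s (suc j) + s (suc j)
      ≡⟨ rearrange (h ∸ suc r) r (s j) (s (suc j)) ⟩
    (h ∸ suc r) * s j + suc r * s (suc j) + s j
      ∎
    where
    open ≡-Reasoning
    rearrange : ∀ q r a b → suc q * a + r * b + b ≡ q * a + suc r * b + a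
    rearrange = solve-∀

  staircase-increasing : StrictlyIncreasing s → StrictlyIncreasing staircase
  staircase-increasing s↑ t = ℕ.+-cancelʳ-< (s q) (staircase t) (staircase (suc t)) (begin-strict
    staircase t + s q                ≡⟨⟩
    stair q r + s q                  <⟨ ℕ.+-monoʳ-< (stair q r) (s↑ q) ⟩
    stair q r + s (suc q)            ≡⟨ stair-suc q r<h ⟩
    stair q (suc r) + s q            ≡⟨ cong (_+ s q) (staircase-suc q r<h) ⟨
    staircase (suc r + q * h) + s q  ≡⟨ cong (λ u → staircase (suc u) + s q) (m≡m%n+[m/n]*n t h) ⟨
    staircase (suc t) + s q          ∎)
    where
    open ℕ.≤-Reasoning
    q = t / h
    r = t % h
    r<h = m%n<n t h

  chain : ℕ → List ℤ
  chain k = map (oddExtension staircase) (symmetricRange (h * k))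

  length-chain : ∀ k → length (chain k) ≡ suc (h * k + h * k)
  length-chain k =
    trans (length-map (oddExtension staircase) (symmetricRange (h * k))) (length-symmetricRange (h * k))

  chain-unique : StrictlyIncreasing s → ∀ k → Unique (chain k)
  chain-unique s↑ k =
    Unique.map⁺ (oddExtension-injective (staircase-increasing s↑)) (symmetricRange-unique (h * k))

  +∈chain⇒onStaircase : StrictlyIncreasing s → ∀ {k e} → + e ∈ chain k → ∃ λ u → e ≡ staircase u
  +∈chain⇒onStaircase s↑ {k} e∈chain =
    let (y , _ , e≡fy) = ∈-map⁻ (oddExtension staircase) {xs = symmetricRange (h * k)} e∈chain
        (u , _ , e≡fu) = oddExtension-nonneg (staircase-increasing s↑) {y} (sym e≡fy)
    in u , e≡fu

  module _ {A : List ℕ} {k : ℕ} (s-enum : Enumerates s (suc k) A) where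

    stair∈sumset : ∀ {j r} → r ≤ h → j < k → InSumset h A (stair j r)
    stair∈sumset {j} {r} r≤h j<k =
      subst (λ n → InSumset n A (stair j r)) (ℕ.m∸n+n≡m r≤h)
            (InSumset-+ {A = A} (InSumset-replicate (enumerates-∈ s-enum (s≤s (ℕ.<⇒≤ j<k))) (h ∸ r))
                                (InSumset-replicate (enumerates-∈ s-enum (s≤s j<k)) r))

    staircase∈sumset : ∀ {t} → t ≤ h * k → InSumset h A (staircase t)
    staircase∈sumset {t} t≤hk =
      subst (λ u → InSumset h A (staircase u)) (sym (m≡m%n+[m/n]*n t h))
            (point∈sumset (t / h) (m%n<n t h) (subst (_≤ h * k) (m≡m%n+[m/n]*n t h) t≤hk))
      where
      point∈sumset : ∀ j {r} → r < h → r + j * h ≤ h * k → InSumset h A (staircase (r + j * h))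
      point∈sumset j {zero} 0<h jh≤hk =
        subst (InSumset h A) (sym (trans (staircase-+* j 0<h) (ℕ.+-identityʳ (h * s j))))
              (InSumset-replicate (enumerates-∈ s-enum (s≤s j≤k)) h)
        where
        j≤k : j ≤ k
        j≤k = ℕ.*-cancelʳ-≤ j k h (subst (j * h ≤_) (ℕ.*-comm h k) jh≤hk)
      point∈sumset j {suc r} 1+r<h 1+r+jh≤hk =
        subst (InSumset h A) (sym (staircase-+* j 1+r<h)) (stair∈sumset (ℕ.<⇒≤ 1+r<h) j<k)
        where
        j<k : j < k
        j<k = ℕ.*-cancelʳ-< h j k (subst (j * h <_) (ℕ.*-comm h k)
                (ℕ.<-≤-trans (ℕ.m<n+m (j * h) (s≤s (z≤n {r}))) 1+r+jh≤hk))

    chain⊆signedSumset : ∀ {x} → x ∈ chain k → InSignedSumset h A x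
    chain⊆signedSumset x∈chain with ∈-map⁻ (oddExtension staircase) x∈chain
    ... | + t      , y∈ , refl = InSumset⇒InSignedSumset {A = A} (staircase∈sumset (∈-symmetricRange⁻ y∈))
    ... | -[1+ t ] , y∈ , refl =
      InSignedSumset-neg {A = A} (InSumset⇒InSignedSumset {A = A} (staircase∈sumset (∈-symmetricRange⁻ y∈)))

    HasCard⇒sumset⊆staircase : StrictlyIncreasing s → HasCard (InSignedSumset h A) (suc (h * k + h * k)) →
                               ∀ {e} → InSumset h A e → ∃ λ u → e ≡ staircase u
    HasCard⇒sumset⊆staircase s↑ card e∈hA =
      +∈chain⇒onStaircase s↑
        (HasCard-saturated card (chain-unique s↑ k) (length-chain k) chain⊆signedSumset
                           (InSumset⇒InSignedSumset {A = A} e∈hA))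

module _ (h : ℕ) .{{_ : NonZero h}} (d : ℕ) where
  open Staircase h (d *_)

  staircase-dilation : ∀ t → staircase t ≡ d * t
  staircase-dilation t = begin
    (h ∸ r) * (d * q) + r * (d * suc q)   ≡⟨ rearrange (h ∸ r) r d q ⟩
    d * (r + q * (h ∸ r + r))             ≡⟨ cong (λ m → d * (r + q * m)) (ℕ.m∸n+n≡m (ℕ.<⇒≤ (m%n<n t h))) ⟩
    d * (r + q * h)                       ≡⟨ cong (d *_) (m≡m%n+[m/n]*n t h) ⟨
    d * t                                 ∎
    where
    open ≡-Reasoning
    q = t / h
    r = t % h
    rearrange : ∀ p r d q → p * (d * q) + r * (d * suc q) ≡ d * (r + q * (p + r))
    rearrange = solve-∀

  oddExtension-dilation : ∀ y → oddExtension staircase y ≡ + d ℤ.* y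
  oddExtension-dilation (+ t)    = trans (cong +_ (staircase-dilation t)) (ℤ.pos-* d t)
  oddExtension-dilation -[1+ t ] =
    trans (cong ℤ.-_ (oddExtension-dilation (+ suc t))) (ℤ.neg-distribʳ-* (+ d) (+ suc t))

  dilatedInterval-HasCard : 0 < d → ∀ {A k} → IsDilatedInterval A d (suc k) →
                            HasCard (InSignedSumset h A) (suc (h * k + h * k))
  dilatedInterval-HasCard 0<d {A} {k} dil =
    chain k , chain-unique d↑ k , length-chain k , λ x → mk⇔ (chain⊆signedSumset dil) signedSumset⊆chain
    where
    d↑ : StrictlyIncreasing (d *_)
    d↑ t = ℕ.*-monoʳ-< d {{>-nonZero 0<d}} (ℕ.n<1+n t)
    dilated : ∀ i → ∃ λ m → m < suc k × lookup A i ≡ d * m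
    dilated i = Equivalence.to (dil (lookup A i)) (∈-lookup i)
    m : Fin (length A) → ℕ
    m i = proj₁ (dilated i)
    signedSumset⊆chain : ∀ {x} → InSignedSumset h A x → x ∈ chain k
    signedSumset⊆chain (c , ∑∣c∣≡h , refl) =
      subst (_∈ chain k) (trans (oddExtension-dilation y) (sym ∑ca≡dy))
            (∈-map⁺ (oddExtension staircase) {x = y} (∈-symmetricRange⁺ ∣y∣≤hk))
      where
      y = sumℤ (λ i → c i ℤ.* + m i)
      ∑ca≡dy : sumℤ (λ i → c i ℤ.* + lookup A i) ≡ + d ℤ.* y
      ∑ca≡dy = trans (sumℤ-cong (λ i → cong (λ a → c i ℤ.* + a) (proj₂ (proj₂ (dilated i)))))
                     (sumℤ-dilated d c m)
      ∣y∣≤hk : ∣ y ∣ ≤ h * k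
      ∣y∣≤hk = subst (λ w → ∣ y ∣ ≤ w * k) ∑∣c∣≡h
                     (∣sumℤ-*∣≤ k c m (λ i → ℕ.≤-pred (proj₁ (proj₂ (dilated i)))))

module _ (g : ℕ) {s : ℕ → ℕ} (s↑ : StrictlyIncreasing s) {A : List ℕ} {k : ℕ}
         (s-enum : Enumerates s (suc k) A) where
  open Staircase (suc (suc g)) s

  -- (1 + i) · h − 1: the last step before the staircase reaches h · s (1 + i)
  corner : ℕ → ℕ
  corner i = suc g + i * suc (suc g)

  staircase-corner : ∀ i → staircase (corner i) ≡ s i + (s (1 + i) + g * s (1 + i))
  staircase-corner i = trans (staircase-+* i (ℕ.n<1+n (suc g)))
    (trans (cong (λ m → m * s i + suc g * s (1 + i)) (ℕ.m+n∸n≡m 1 g))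
           (cong (_+ suc g * s (1 + i)) (ℕ.*-identityˡ (s i))))

  staircase-1+corner : ∀ i → staircase (1 + corner i) ≡ s (1 + i) + (s (1 + i) + g * s (1 + i))
  staircase-1+corner i = trans (staircase-suc i (ℕ.n<1+n (suc g)))
    (cong (λ m → m * s i + suc (suc g) * s (1 + i)) (ℕ.n∸n≡0 g))

  staircase-2+corner : ∀ i → staircase (2 + corner i) ≡ s (1 + i) + g * s (1 + i) + s (2 + i)
  staircase-2+corner i = trans (staircase-+* (suc i) (s≤s (s≤s z≤n)))
    (cong (_+_ (s (1 + i) + g * s (1 + i))) (ℕ.*-identityˡ (s (2 + i))))

  -- The h-fold sum s i + s (2 + i) + g · s (1 + i) lies strictly between the staircase points at
  -- corner i and 2 + corner i, so it is the point h · s (1 + i) between them.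
  sumset⊆staircase⇒equallySpaced : (∀ {e} → InSumset (suc (suc g)) A e → ∃ λ u → e ≡ staircase u) →
                                   ∀ i → 2 + i ≤ k → s i + s (2 + i) ≡ s (1 + i) + s (1 + i)
  sumset⊆staircase⇒equallySpaced onStaircase i 2+i≤k =
    ℕ.+-cancelʳ-≡ (g * b) (a + c) (b + b)
      (trans (ℕ.+-assoc a c (g * b)) (trans e≡2b+gb (sym (ℕ.+-assoc b b (g * b)))))
    where
    a = s i
    b = s (1 + i)
    c = s (2 + i)
    e = a + (c + g * b)
    ∈A : ∀ j → j ≤ 2 + i → s j ∈ A
    ∈A j j≤2+i = enumerates-∈ s-enum (s≤s (ℕ.≤-trans j≤2+i 2+i≤k))
    e∈hA : InSumset (suc (suc g)) A e
    e∈hA = InSumset-+ {A = A} (InSumset-single (∈A i (ℕ.m≤n+m i 2)))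
             (InSumset-+ {A = A} (InSumset-single (∈A (2 + i) ℕ.≤-refl))
                                 (InSumset-replicate (∈A (1 + i) (ℕ.n≤1+n _)) g))
    u = proj₁ (onStaircase e∈hA)
    e≡fu = proj₂ (onStaircase e∈hA)
    below : staircase (corner i) < staircase u
    below = begin-strict
      staircase (corner i)  ≡⟨ staircase-corner i ⟩
      a + (b + g * b)       <⟨ ℕ.+-monoʳ-< a (ℕ.+-monoˡ-< (g * b) (s↑ (1 + i))) ⟩
      e                     ≡⟨ e≡fu ⟩
      staircase u           ∎
      where open ℕ.≤-Reasoning
    above : staircase u < staircase (2 + corner i)
    above = begin-strict
      staircase u               ≡⟨ e≡fu ⟨
      a + (c + g * b)           <⟨ ℕ.+-monoˡ-< (c + g * b) (s↑ i) ⟩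
      b + (c + g * b)           ≡⟨ rearrange b c (g * b) ⟩
      b + g * b + c             ≡⟨ staircase-2+corner i ⟨
      staircase (2 + corner i)  ∎
      where
      open ℕ.≤-Reasoning
      rearrange : ∀ x y z → x + (y + z) ≡ x + z + y
      rearrange = solve-∀
    e≡2b+gb : e ≡ b + (b + g * b)
    e≡2b+gb = trans e≡fu
      (trans (cong staircase (strictlyIncreasing-between (staircase-increasing s↑) {corner i} {u} below above))
             (staircase-1+corner i))

module _ {s : ℕ → ℕ} (s0≡0 : s 0 ≡ 0) {k : ℕ}
         (equallySpaced : ∀ i → 2 + i ≤ k → s i + s (2 + i) ≡ s (1 + i) + s (1 + i)) where

  equallySpaced⇒linear : ∀ j → j ≤ k → s j ≡ j * s 1
  equallySpaced⇒linear zero          _     = s0≡0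
  equallySpaced⇒linear (suc zero)    _     = sym (ℕ.*-identityˡ (s 1))
  equallySpaced⇒linear (suc (suc j)) 2+j≤k = ℕ.+-cancelˡ-≡ (j * d) (s (2 + j)) ((2 + j) * d) (begin
    j * d + s (2 + j)           ≡⟨ cong (_+ s (2 + j)) (equallySpaced⇒linear j (ℕ.≤-trans (ℕ.m≤n+m j 2) 2+j≤k)) ⟨
    s j + s (2 + j)             ≡⟨ equallySpaced j 2+j≤k ⟩
    s (1 + j) + s (1 + j)       ≡⟨ cong (λ m → m + m) (equallySpaced⇒linear (suc j) (ℕ.≤-trans (ℕ.n≤1+n _) 2+j≤k)) ⟩
    (1 + j) * d + (1 + j) * d   ≡⟨ rearrange j d ⟩
    j * d + (2 + j) * d         ∎)
    where
    open ≡-Reasoning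
    d = s 1
    rearrange : ∀ j d → (1 + j) * d + (1 + j) * d ≡ j * d + (2 + j) * d
    rearrange = solve-∀

2h[1+k]∸2h+1≡1+hk+hk : ∀ h k → 2 * h * suc k ∸ 2 * h + 1 ≡ suc (h * k + h * k)
2h[1+k]∸2h+1≡1+hk+hk h k = begin
  2 * h * suc k ∸ 2 * h + 1       ≡⟨ cong (λ m → m ∸ 2 * h + 1) (ℕ.*-suc (2 * h) k) ⟩
  2 * h + 2 * h * k ∸ 2 * h + 1   ≡⟨ cong (_+ 1) (ℕ.m+n∸m≡n (2 * h) (2 * h * k)) ⟩
  2 * h * k + 1                   ≡⟨ rearrange h k ⟩
  suc (h * k + h * k)             ∎
  where
  open ≡-Reasoning
  rearrange : ∀ h k → 2 * h * k + 1 ≡ suc (h * k + h * k)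
  rearrange = solve-∀

theorem6 : (h : ℕ) → 2 ≤ h → (A : List ℕ) → Unique A → 0 ∈ A →
    HasCard (InSignedSumset h A) (2 * h * length A ∸ 2 * h + 1)
      ⇔ (∃ λ d → (0 < d) × IsDilatedInterval A d (length A))
theorem6 _ _ [] _ ()
theorem6 h@(suc (suc g)) (s≤s (s≤s z≤n)) A@(_ ∷ A′) A! 0∈A =
  subst (λ n → HasCard (InSignedSumset h A) n ⇔ (∃ λ d → (0 < d) × IsDilatedInterval A d (length A)))
        (sym (2h[1+k]∸2h+1≡1+hk+hk h k)) (mk⇔ forward backward)
  where
  k = length A′
  forward : HasCard (InSignedSumset h A) (suc (h * k + h * k)) →
            ∃ λ d → (0 < d) × IsDilatedInterval A d (length A)
  forward card with increasingEnumeration A A!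
  ... | s , s↑ , s-enum =
    s 1 , subst (_< s 1) s0≡0 (s↑ 0) ,
    enumerates-cong s-enum (λ j j<1+k → trans (linear j (ℕ.≤-pred j<1+k)) (ℕ.*-comm j (s 1)))
    where
    s0≡0 : s 0 ≡ 0
    s0≡0 = let (j , _ , 0≡sj) = Equivalence.to (s-enum 0) 0∈A in
           ℕ.n≤0⇒n≡0 (subst (s 0 ≤_) (sym 0≡sj) (strictlyIncreasing-mono-≤ s↑ z≤n))
    linear : ∀ j → j ≤ k → s j ≡ j * s 1
    linear = equallySpaced⇒linear s0≡0 (sumset⊆staircase⇒equallySpaced g s↑ s-enum
               (Staircase.HasCard⇒sumset⊆staircase h s s-enum s↑ card))
  backward : (∃ λ d → (0 < d) × IsDilatedInterval A d (length A)) →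
             HasCard (InSignedSumset h A) (suc (h * k + h * k))
  backward (d , 0<d , dil) = dilatedInterval-HasCard h d 0<d dil
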